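{- Let $F:\mathbb{N}^+\times\mathbb{N}^+\to\mathbb{N}^+$ be defined by $$F(m,n)=\frac{1}{4}\left[(m+n-1)^2-\big((m+n-1)\bmod 2\big)\right]+\min(m,n).$$ Let $S_O=\{(x,y)\in\mathbb{N}^+\times\mathbb{N}^+ : x\ge y\}$, ordered as follows: $(x_1,y_1)$ precedes $(x_2,y_2)$ if $x_1+y_1<x_2+y_2$, or if $x_1+y_1=x_2+y_2$ and $y_1<y_2$; let $S_O(k)$ denote the $k$-th element of $S_O$ in this order ($k\ge 1$). If $(x_1,y_1)=S_O(a)$ and $(x_2,y_2)=S_O(b)$ with $a<b$, then $F(x_1,y_1)<F(x_2,y_2)$.
   Context: $\mathbb{N}^+$ denotes the set of positive integers. For an integer $k$, $k\bmod 2$ denotes the least non-negative residue of $k$ modulo $2$. -}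

module Defs where

open import Data.Nat using (ℕ; zero; suc; _+_; _*_; _∸_; _<_; _≤_; _⊓_; _≤?_; _<?_)
open import Data.Nat.DivMod using (_/_; _%_)
open import Data.Nat.Properties using (_≟_)
open import Data.Product using (_×_; _,_)
open import Data.Sum using (_⊎_)
open import Data.List using (List; length; filter; upTo; map; concatMap)
open import Relation.Binary.PropositionalEquality using (_≡_)
open import Relation.Nullary using (Dec)
open import Relation.Nullary.Decidable using (_×-dec_; _⊎-dec_)

-- F(m,n) = ((m+n-1)^2 - ((m+n-1) mod 2)) / 4 + min(m,n)
-- (the numerator is always divisible by 4, so ℕ-division is exact)
F : ℕ → ℕ → ℕ
F m n = ((m + n ∸ 1) * (m + n ∸ 1) ∸ ((m + n ∸ 1) % 2)) / 4 + (m ⊓ n)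

InSO : ℕ × ℕ → Set
InSO (x , y) = 1 ≤ y × y ≤ x

inSO? : (p : ℕ × ℕ) → Dec (InSO p)
inSO? (x , y) = (1 ≤? y) ×-dec (y ≤? x)

Precedes : ℕ × ℕ → ℕ × ℕ → Set
Precedes (x₁ , y₁) (x₂ , y₂) =
  (x₁ + y₁ < x₂ + y₂) ⊎ ((x₁ + y₁ ≡ x₂ + y₂) × (y₁ < y₂))

precedes? : (p q : ℕ × ℕ) → Dec (Precedes p q)
precedes? (x₁ , y₁) (x₂ , y₂) =
  (x₁ + y₁ <? x₂ + y₂) ⊎-dec ((x₁ + y₁ ≟ x₂ + y₂) ×-dec (y₁ <? y₂))

-- all pairs (x,y) with x,y ∈ {0,…,s}; every element of S_O preceding a pair
-- with coordinate sum s lies in this box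
box : ℕ → List (ℕ × ℕ)
box s = concatMap (λ x → map (λ y → (x , y)) (upTo (suc s))) (upTo (suc s))

rankSO : ℕ × ℕ → ℕ
rankSO (x , y) =
  length (filter (λ q → inSO? q ×-dec precedes? q (x , y)) (box (x + y)))

IsKthSO : ℕ → ℕ × ℕ → Set
IsKthSO k p = InSO p × 1 ≤ k × suc (rankSO p) ≡ k

-- On S_O the minimum in F is y, and the bracket divided by 4 is the quarter-square
-- q(n) = ⌊n/2⌋⌈n/2⌉ of n = x + y − 1, so F(x,y) = q(x + y − 1) + y. Since
-- q(n + 1) = q(n) + ⌈n/2⌉ and 2y ≤ x + y, raising y along one antidiagonal never
-- reaches the value at the start of the next one: F is strictly increasing for
-- the order of S_O. Conversely the rank of a point of S_O is monotone in that
-- (total) order, so a smaller index means an earlier point, hence a smaller F.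
module Submission where

open import Defs
open import Data.Nat using (ℕ; _<_)
open import Data.Product using (_,_)

open import Data.Nat.Base
  using (zero; suc; _+_; _*_; _∸_; _≤_; _≤′_; ≤′-refl; ≤′-step; z≤n; s≤s; s<s⁻¹; pred;
         ⌊_/2⌋; ⌈_/2⌉)
open import Data.Nat.Properties
open import Data.Nat.DivMod using (_/_; _%_; m*n%n≡0; [m+kn]%n≡m%n; m*n/n≡m)
open import Data.Nat.Solver using (module +-*-Solver)
open import Data.Product using (_×_; Σ-syntax; map₂)
open import Data.Sum using (_⊎_; inj₁; inj₂)
open import Data.List using (List; applyUpTo; concatMap)
import Data.List.Relation.Binary.Sublist.Heterogeneous as Sublist
import Data.List.Relation.Binary.Sublist.Heterogeneous.Properties as Sublist
open import Data.List.Relation.Binary.Sublist.Propositional using (_⊆_; _∷_)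
open import Data.List.Relation.Binary.Sublist.Propositional.Properties
  using ([]⊆-universal; concat⁺; filter⁺; length-mono-≤; map⁺)
open import Function using (_∘_)
open import Relation.Binary.PropositionalEquality
open import Relation.Nullary using (¬_)
open import Relation.Nullary.Decidable using (decidable-stable; _×-dec_)

quarterSquare : ℕ → ℕ
quarterSquare n = ⌊ n /2⌋ * ⌈ n /2⌉

parity : ∀ n → Σ[ k ∈ ℕ ] (n ≡ k * 2 ⊎ n ≡ suc (k * 2))
parity zero = 0 , inj₁ refl
parity (suc n) with parity n
... | k , inj₁ n≡2k   = k , inj₂ (cong suc n≡2k)
... | k , inj₂ n≡2k+1 = suc k , inj₁ (cong suc n≡2k+1)

⌊k*2/2⌋≡k : ∀ k → ⌊ k * 2 /2⌋ ≡ k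
⌊k*2/2⌋≡k zero    = refl
⌊k*2/2⌋≡k (suc k) = cong suc (⌊k*2/2⌋≡k k)

⌈k*2/2⌉≡k : ∀ k → ⌈ k * 2 /2⌉ ≡ k
⌈k*2/2⌉≡k zero    = refl
⌈k*2/2⌉≡k (suc k) = cong suc (⌈k*2/2⌉≡k k)

square∸parity≡quarterSquare*4 : ∀ n → n * n ∸ n % 2 ≡ quarterSquare n * 4
square∸parity≡quarterSquare*4 n with parity n
... | k , inj₁ refl = begin
  k * 2 * (k * 2) ∸ (k * 2) % 2 ≡⟨ cong (k * 2 * (k * 2) ∸_) (m*n%n≡0 k 2) ⟩
  k * 2 * (k * 2)               ≡⟨ solve 1 (λ k → k :* con 2 :* (k :* con 2) := k :* k :* con 4)
                                           refl k ⟩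
  k * k * 4                     ≡⟨ cong (_* 4) (cong₂ _*_ (⌊k*2/2⌋≡k k) (⌈k*2/2⌉≡k k)) ⟨
  quarterSquare (k * 2) * 4     ∎
  where open ≡-Reasoning; open +-*-Solver
... | k , inj₂ refl = begin
  suc (k * 2) * suc (k * 2) ∸ (1 + k * 2) % 2 ≡⟨ cong (suc (k * 2) * suc (k * 2) ∸_)
                                                       ([m+kn]%n≡m%n 1 k 2) ⟩
  suc (k * 2) * suc (k * 2) ∸ 1               ≡⟨ cong (_∸ 1) (solve 1 (λ k →
      (con 1 :+ k :* con 2) :* (con 1 :+ k :* con 2) := con 1 :+ k :* (con 1 :+ k) :* con 4)
      refl k) ⟩
  k * suc k * 4                               ≡⟨ cong (_* 4) (cong₂ _*_ (⌈k*2/2⌉≡k k)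
                                                                  (cong suc (⌊k*2/2⌋≡k k))) ⟨
  quarterSquare (suc (k * 2)) * 4             ∎
  where open ≡-Reasoning; open +-*-Solver

-- ⌊ suc n /2⌋ is ⌈ n /2⌉ and ⌈ suc n /2⌉ is suc ⌊ n /2⌋, both definitionally.
quarterSquare-suc : ∀ n → quarterSquare (suc n) ≡ quarterSquare n + ⌈ n /2⌉
quarterSquare-suc n = begin
  ⌈ n /2⌉ * suc ⌊ n /2⌋      ≡⟨ *-suc ⌈ n /2⌉ ⌊ n /2⌋ ⟩
  ⌈ n /2⌉ + ⌈ n /2⌉ * ⌊ n /2⌋ ≡⟨ +-comm ⌈ n /2⌉ _ ⟩
  ⌈ n /2⌉ * ⌊ n /2⌋ + ⌈ n /2⌉ ≡⟨ cong (_+ ⌈ n /2⌉) (*-comm ⌈ n /2⌉ ⌊ n /2⌋) ⟩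
  quarterSquare n + ⌈ n /2⌉   ∎
  where open ≡-Reasoning

quarterSquare-mono : ∀ {m n} → m ≤ n → quarterSquare m ≤ quarterSquare n
quarterSquare-mono = go ∘ ≤⇒≤′
  where
  go : ∀ {m n} → m ≤′ n → quarterSquare m ≤ quarterSquare n
  go ≤′-refl = ≤-refl
  go {n = suc n} (≤′-step m≤′n) =
    ≤-trans (go m≤′n) (≤-trans (m≤m+n _ ⌈ n /2⌉) (≤-reflexive (sym (quarterSquare-suc n))))

m+m≤n⇒m≤⌊n/2⌋ : ∀ {m n} → m + m ≤ n → m ≤ ⌊ n /2⌋
m+m≤n⇒m≤⌊n/2⌋ {m} m+m≤n = subst (_≤ _) (sym (n≡⌊n+n/2⌋ m)) (⌊n/2⌋-mono m+m≤n)

quarterSquare-step : ∀ {y n} → y + y ≤ suc n → quarterSquare n + y ≤ quarterSquare (suc n)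
quarterSquare-step {y} {n} y+y≤1+n = begin
  quarterSquare n + y       ≤⟨ +-monoʳ-≤ (quarterSquare n) (m+m≤n⇒m≤⌊n/2⌋ y+y≤1+n) ⟩
  quarterSquare n + ⌈ n /2⌉ ≡⟨ quarterSquare-suc n ⟨
  quarterSquare (suc n)     ∎
  where open ≤-Reasoning

quarterSquare-pred-lex : ∀ {s₁ y₁ s₂ y₂} → 1 ≤ y₁ → y₁ + y₁ ≤ s₁ → 1 ≤ y₂ →
                         s₁ < s₂ ⊎ (s₁ ≡ s₂ × y₁ < y₂) →
                         quarterSquare (pred s₁) + y₁ < quarterSquare (pred s₂) + y₂
quarterSquare-pred-lex {s₁} _ _ _ (inj₂ (refl , y₁<y₂)) =
  +-monoʳ-< (quarterSquare (pred s₁)) y₁<y₂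
quarterSquare-pred-lex {zero} {suc _} _ () _ _
quarterSquare-pred-lex {suc n₁} {y₁} {suc n₂} {y₂} _ y₁+y₁≤s₁ 1≤y₂ (inj₁ (s≤s n₁<n₂)) =
  begin-strict
  quarterSquare n₁ + y₁  ≤⟨ quarterSquare-step y₁+y₁≤s₁ ⟩
  quarterSquare (suc n₁) ≤⟨ quarterSquare-mono n₁<n₂ ⟩
  quarterSquare n₂       <⟨ m<m+n (quarterSquare n₂) 1≤y₂ ⟩
  quarterSquare n₂ + y₂  ∎
  where open ≤-Reasoning

F-on-SO : ∀ {x y} → y ≤ x → F x y ≡ quarterSquare (pred (x + y)) + y
F-on-SO {x} {y} y≤x = cong₂ _+_
  (trans (cong (_/ 4) (square∸parity≡quarterSquare*4 n)) (m*n/n≡m (quarterSquare n) 4))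
  (m≥n⇒m⊓n≡n y≤x)
  where n = pred (x + y)

F-mono-Precedes : ∀ {x₁ y₁ x₂ y₂} → InSO (x₁ , y₁) → InSO (x₂ , y₂) →
                  Precedes (x₁ , y₁) (x₂ , y₂) → F x₁ y₁ < F x₂ y₂
F-mono-Precedes {x₁} {y₁} {x₂} {y₂} (1≤y₁ , y₁≤x₁) (1≤y₂ , y₂≤x₂) prec = begin-strict
  F x₁ y₁                             ≡⟨ F-on-SO y₁≤x₁ ⟩
  quarterSquare (pred (x₁ + y₁)) + y₁ <⟨ quarterSquare-pred-lex 1≤y₁ (+-monoˡ-≤ y₁ y₁≤x₁) 1≤y₂ prec ⟩
  quarterSquare (pred (x₂ + y₂)) + y₂ ≡⟨ F-on-SO y₂≤x₂ ⟨
  F x₂ y₂                             ∎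
  where open ≤-Reasoning

¬Precedes⇒sum-≥ : ∀ {x₁ y₁ x₂ y₂} → ¬ Precedes (x₁ , y₁) (x₂ , y₂) → x₂ + y₂ ≤ x₁ + y₁
¬Precedes⇒sum-≥ np = ≮⇒≥ (np ∘ inj₁)

Precedes-≮-trans : ∀ {p x₁ y₁ x₂ y₂} → ¬ Precedes (x₁ , y₁) (x₂ , y₂) →
                   Precedes p (x₂ , y₂) → Precedes p (x₁ , y₁)
Precedes-≮-trans np (inj₁ s<s₂) = inj₁ (<-≤-trans s<s₂ (¬Precedes⇒sum-≥ np))
Precedes-≮-trans np (inj₂ (s≡s₂ , y<y₂)) with m≤n⇒m<n∨m≡n (¬Precedes⇒sum-≥ np)
... | inj₁ s₂<s₁ = inj₁ (≤-<-trans (≤-reflexive s≡s₂) s₂<s₁)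
... | inj₂ s₂≡s₁ = inj₂ (trans s≡s₂ s₂≡s₁ , <-≤-trans y<y₂ (≮⇒≥ (np ∘ inj₂ ∘ (sym s₂≡s₁ ,_))))

applyUpTo⁺ : ∀ {A : Set} (f : ℕ → A) {m n} → m ≤ n → applyUpTo f m ⊆ applyUpTo f n
applyUpTo⁺ f z≤n       = []⊆-universal _
applyUpTo⁺ f (s≤s m≤n) = refl ∷ applyUpTo⁺ (f ∘ suc) m≤n

concatMap⁺ : ∀ {A B : Set} {f g : A → List B} {xs ys : List A} →
             (∀ x → f x ⊆ g x) → xs ⊆ ys → concatMap f xs ⊆ concatMap g ys
concatMap⁺ {f = f} {g} f⊆g xs⊆ys =
  concat⁺ (Sublist.map⁺ f g (Sublist.map (λ { refl → f⊆g _ }) xs⊆ys))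

box-mono : ∀ {s t} → s ≤ t → box s ⊆ box t
box-mono s≤t = concatMap⁺ (λ x → map⁺ (x ,_) upTo⁺) upTo⁺
  where upTo⁺ = applyUpTo⁺ (λ i → i) (s≤s s≤t)

rankSO-≮-mono : ∀ {x₁ y₁ x₂ y₂} → ¬ Precedes (x₁ , y₁) (x₂ , y₂) →
                rankSO (x₂ , y₂) ≤ rankSO (x₁ , y₁)
rankSO-≮-mono np = length-mono-≤
  (filter⁺ (λ q → inSO? q ×-dec precedes? q _) (λ q → inSO? q ×-dec precedes? q _)
           (λ { refl → map₂ (Precedes-≮-trans np) })
           (box-mono (¬Precedes⇒sum-≥ np)))

rankSO-<⇒Precedes : ∀ {x₁ y₁ x₂ y₂} → rankSO (x₁ , y₁) < rankSO (x₂ , y₂) →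
                    Precedes (x₁ , y₁) (x₂ , y₂)
rankSO-<⇒Precedes r₁<r₂ = decidable-stable (precedes? _ _) (<⇒≱ r₁<r₂ ∘ rankSO-≮-mono)

lemma5 : (x₁ y₁ x₂ y₂ a b : ℕ) →
         IsKthSO a (x₁ , y₁) → IsKthSO b (x₂ , y₂) → a < b →
         F x₁ y₁ < F x₂ y₂
lemma5 _ _ _ _ _ _ (p∈SO , _ , refl) (q∈SO , _ , refl) a<b =
  F-mono-Precedes p∈SO q∈SO (rankSO-<⇒Precedes (s<s⁻¹ a<b))
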